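{- Let $u$ be an integer with $u\neq 0,\pm1$, and let \begin{align*} a &= 2(u^6+2u^5+u^4-4u^2-4u-4)^2(u^6-2u^5+u^4-4u^2+4u-4)^2 (u^3-u^2+u-2)^2(u^3+u^2+u+2)^2, \\ b &= 2(2u^7-u^6+2u^5-u^4-6u^3+4u^2-8u+4)^2 (2u^7+u^6+2u^5+u^4-6u^3-4u^2-8u-4)^2 (u^4-2)^2, \\ c &= 2(u^2+1)^2(2u^8+u^6-7u^4-4u^2+4)^2 (u^6+u^4-2u^2-4)^2 u^2 (u^4-3)^2, \\ d &= 8(u-1)^2(u+1)^2u^2(u^4-3)^2(u^3-u^2+u-2)^2 (u^3+u^2+u+2)^2 (u^2+1)^4 (u^2+2)^2 (u^2-2)^2. \end{align*} Let \begin{align*} n_1 &= (u-1)^2(u+1)^2(u^4-3)^2(u^2+1)^2(2u^7-u^6+2u^5-u^4-6u^3+4u^2-8u+4)^2 (2u^7+u^6+2u^5+u^4-6u^3-4u^2-8u-4)^2 \\ &\quad\times (u^6+2u^5+u^4-4u^2-4u-4)^2 (u^6-2u^5+u^4-4u^2+4u-4)^2 (u^3-u^2+u-2)^2 (u^3+u^2+u+2)^2, \\ n_2 &= 64(u^2+1)^4 (u^4-2)^2 (2u^8+u^6-7u^4-4u^2+4)^2 (u^6+u^4-2u^2-4)^2 \\ &\quad\times u^4(u^2+2)^2(u^2-2)^2 (u^4-3)^2 (u^3-u^2+u-2)^2 (u^3+u^2+u+2)^2, \\ n_3 &= 0. \end{align*} Then $\{a,b,c,d\}$ is a $D(n_1)$-quadruple,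 a $D(n_2)$-quadruple and a $D(n_3)$-quadruple.
   Context: For an integer $n$ (the case $n=0$ being allowed), a set of four distinct nonzero integers $\{a,b,c,d\}$ is called a $D(n)$-quadruple if the product of any two distinct elements of the set, increased by $n$, is a perfect square of an integer. -}

module Defs where

open import Data.Integer using (ℤ; +_; -_; _+_; _-_; _*_; 0ℤ; 1ℤ; -1ℤ)
open import Data.Nat using (ℕ)
open import Data.Product using (Σ; ∃; _×_)
open import Relation.Binary.PropositionalEquality using (_≡_; _≢_)

IsSquare : ℤ → Set
IsSquare x = ∃ λ (r : ℤ) → r * r ≡ x

DQuadruple : ℤ → ℤ → ℤ → ℤ → ℤ → Set
DQuadruple n a b c d =
  (a ≢ 0ℤ × b ≢ 0ℤ × c ≢ 0ℤ × d ≢ 0ℤ) ×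
  (a ≢ b × a ≢ c × a ≢ d × b ≢ c × b ≢ d × c ≢ d) ×
  (IsSquare (a * b + n) × IsSquare (a * c + n) × IsSquare (a * d + n) ×
   IsSquare (b * c + n) × IsSquare (b * d + n) × IsSquare (c * d + n))

infixr 8 _^_
_^_ : ℤ → ℕ → ℤ
x ^ ℕ.zero = 1ℤ
x ^ ℕ.suc k = x * x ^ k

ι : ℕ → ℤ
ι k = + k

module _ (u : ℤ) where
  P1 P2 P3 P4 Q1 Q2 R1 R2 : ℤ
  P1 = u ^ 6 + ι 2 * u ^ 5 + u ^ 4 - ι 4 * u ^ 2 - ι 4 * u - ι 4
  P2 = u ^ 6 - ι 2 * u ^ 5 + u ^ 4 - ι 4 * u ^ 2 + ι 4 * u - ι 4
  P3 = u ^ 3 - u ^ 2 + u - ι 2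
  P4 = u ^ 3 + u ^ 2 + u + ι 2
  Q1 = ι 2 * u ^ 7 - u ^ 6 + ι 2 * u ^ 5 - u ^ 4 - ι 6 * u ^ 3 + ι 4 * u ^ 2 - ι 8 * u + ι 4
  Q2 = ι 2 * u ^ 7 + u ^ 6 + ι 2 * u ^ 5 + u ^ 4 - ι 6 * u ^ 3 - ι 4 * u ^ 2 - ι 8 * u - ι 4
  R1 = ι 2 * u ^ 8 + u ^ 6 - ι 7 * u ^ 4 - ι 4 * u ^ 2 + ι 4
  R2 = u ^ 6 + u ^ 4 - ι 2 * u ^ 2 - ι 4

  A B C D N1 N2 N3 : ℤ
  A = ι 2 * P1 ^ 2 * P2 ^ 2 * P3 ^ 2 * P4 ^ 2
  B = ι 2 * Q1 ^ 2 * Q2 ^ 2 * (u ^ 4 - ι 2) ^ 2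
  C = ι 2 * (u ^ 2 + ι 1) ^ 2 * R1 ^ 2 * R2 ^ 2 * u ^ 2 * (u ^ 4 - ι 3) ^ 2
  D = ι 8 * (u - ι 1) ^ 2 * (u + ι 1) ^ 2 * u ^ 2 * (u ^ 4 - ι 3) ^ 2 * P3 ^ 2 * P4 ^ 2
        * (u ^ 2 + ι 1) ^ 4 * (u ^ 2 + ι 2) ^ 2 * (u ^ 2 - ι 2) ^ 2
  N1 = (u - ι 1) ^ 2 * (u + ι 1) ^ 2 * (u ^ 4 - ι 3) ^ 2 * (u ^ 2 + ι 1) ^ 2 * Q1 ^ 2 * Q2 ^ 2
        * P1 ^ 2 * P2 ^ 2 * P3 ^ 2 * P4 ^ 2
  N2 = ι 64 * (u ^ 2 + ι 1) ^ 4 * (u ^ 4 - ι 2) ^ 2 * R1 ^ 2 * R2 ^ 2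
        * u ^ 4 * (u ^ 2 + ι 2) ^ 2 * (u ^ 2 - ι 2) ^ 2 * (u ^ 4 - ι 3) ^ 2 * P3 ^ 2 * P4 ^ 2
  N3 = 0ℤ

{-# OPTIONS --safe #-}

-- Each of a, b, c, d is twice a square: a = 2α², b = 2β², c = 2γ², d = 2δ² with α, β, γ, δ
-- products of the factors appearing in a, b, c, d.  Hence xy = (2ξη)² for any two of them,
-- which is the D(0) property, and x ≠ y amounts to (ξ - η)(ξ + η) ≠ 0.  That product, and
-- a, b, c, d themselves, do not vanish at u ∉ {0, ±1}: after dividing out the factors
-- u, u - 1, u + 1 every remaining factor has no root modulo 3, 5 or 7.  For n₁ and n₂ the
-- square roots of xy + n are explicit polynomials, and the squares are polynomial identities
-- in u checked by normalisation.

module Submission where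

open import Defs
open import Data.Bool using (Bool; _∧_; T)
open import Data.Bool.Properties using (T-∧)
open import Data.Fin using (Fin; toℕ; fromℕ<)
open import Data.Fin.Properties using (all?; toℕ-fromℕ<)
open import Data.Integer using (ℤ; +_; -_; _+_; _-_; _*_; 0ℤ; 1ℤ; -1ℤ; _≟_)
open import Data.Integer.DivMod using (_%ℕ_; _/ℕ_; a≡a%ℕn+[a/ℕn]*n; n%ℕd<d)
open import Data.Integer.Divisibility.Signed using (_∣_; _∣?_; divides; ∣m∣n⇒∣m+n; ∣n⇒∣m*n; ∣m⇒∣m*n)
open import Data.Integer.Properties using (+-identityˡ; +-identityʳ; *-zeroˡ; *-zeroʳ; -1*i≡-i; i*j≡0⇒i≡0∨j≡0; i≡j⇒i-j≡0; i-j≡0⇒i≡j)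
open import Data.Integer.Tactic.RingSolver using (solve-∀)
open import Data.List using (List; []; _∷_; length)
open import Data.List.Relation.Unary.All as All using (All; []; _∷_)
open import Data.Nat using (ℕ; zero; suc; NonZero)
open import Data.Product using (_×_; _,_)
open import Data.Sum using (inj₁; inj₂; [_,_]′)
open import Data.Unit using (tt)
open import Function using (_∘_; Equivalence)
open import Relation.Nullary using (¬_; Dec; yes; no; ¬?)
open import Relation.Nullary.Decidable using (True; isYes; toWitness)
open import Relation.Binary.PropositionalEquality

Poly : Set
Poly = List ℤ

⟦_⟧ₚ : Poly → ℤ → ℤ
⟦ [] ⟧ₚ x = 0ℤ
⟦ c ∷ p ⟧ₚ x = c + x * ⟦ p ⟧ₚ x

infixl 6 _+ₚ_
infixl 7 _*ₚ_ _·ₚ_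
infixr 8 _^ₚ_

_+ₚ_ : Poly → Poly → Poly
[] +ₚ q = q
(c ∷ p) +ₚ [] = c ∷ p
(c ∷ p) +ₚ (d ∷ q) = c + d ∷ p +ₚ q

_·ₚ_ : ℤ → Poly → Poly
c ·ₚ [] = []
c ·ₚ (d ∷ p) = c * d ∷ c ·ₚ p

_*ₚ_ : Poly → Poly → Poly
[] *ₚ q = []
(c ∷ p) *ₚ q = c ·ₚ q +ₚ (0ℤ ∷ p *ₚ q)

_^ₚ_ : Poly → ℕ → Poly
p ^ₚ zero = 1ℤ ∷ []
p ^ₚ suc n = p *ₚ p ^ₚ n

⟦⟧ₚ-+ : ∀ p q x → ⟦ p +ₚ q ⟧ₚ x ≡ ⟦ p ⟧ₚ x + ⟦ q ⟧ₚ x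
⟦⟧ₚ-+ [] q x = sym (+-identityˡ _)
⟦⟧ₚ-+ (c ∷ p) [] x = sym (+-identityʳ _)
⟦⟧ₚ-+ (c ∷ p) (d ∷ q) x rewrite ⟦⟧ₚ-+ p q x = step c d x (⟦ p ⟧ₚ x) (⟦ q ⟧ₚ x)
  where
  step : ∀ c d x s t → c + d + x * (s + t) ≡ (c + x * s) + (d + x * t)
  step = solve-∀

⟦⟧ₚ-· : ∀ c p x → ⟦ c ·ₚ p ⟧ₚ x ≡ c * ⟦ p ⟧ₚ x
⟦⟧ₚ-· c [] x = sym (*-zeroʳ c)
⟦⟧ₚ-· c (d ∷ p) x rewrite ⟦⟧ₚ-· c p x = step c d x (⟦ p ⟧ₚ x)
  where
  step : ∀ c d x s → c * d + x * (c * s) ≡ c * (d + x * s)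
  step = solve-∀

⟦⟧ₚ-* : ∀ p q x → ⟦ p *ₚ q ⟧ₚ x ≡ ⟦ p ⟧ₚ x * ⟦ q ⟧ₚ x
⟦⟧ₚ-* [] q x = sym (*-zeroˡ (⟦ q ⟧ₚ x))
⟦⟧ₚ-* (c ∷ p) q x
  rewrite ⟦⟧ₚ-+ (c ·ₚ q) (0ℤ ∷ p *ₚ q) x | ⟦⟧ₚ-· c q x | ⟦⟧ₚ-* p q x
  = step c x (⟦ p ⟧ₚ x) (⟦ q ⟧ₚ x)
  where
  step : ∀ c x s t → c * t + (0ℤ + x * (s * t)) ≡ (c + x * s) * t
  step = solve-∀

⟦⟧ₚ-^ : ∀ p n x → ⟦ p ^ₚ n ⟧ₚ x ≡ ⟦ p ⟧ₚ x ^ n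
⟦⟧ₚ-^ p zero x = cong (λ t → 1ℤ + t) (*-zeroʳ x)
⟦⟧ₚ-^ p (suc n) x rewrite ⟦⟧ₚ-* p (p ^ₚ n) x | ⟦⟧ₚ-^ p n x = refl

⟦⟧ₚ-zero : ∀ {p} → All (_≡ 0ℤ) p → ∀ x → ⟦ p ⟧ₚ x ≡ 0ℤ
⟦⟧ₚ-zero [] x = refl
⟦⟧ₚ-zero (refl ∷ p≡0) x rewrite ⟦⟧ₚ-zero p≡0 x = cong (λ t → 0ℤ + t) (*-zeroʳ x)

infixl 6 _:+_ _:-_
infixl 7 _:*_
infixr 8 _:^_

data Expr : Set where
  var : Expr
  con : ℤ → Expr
  _:+_ _:-_ _:*_ : Expr → Expr → Expr
  _:^_ : Expr → ℕ → Expr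
  named : (f : ℤ → ℤ) (p : Poly) → (∀ x → ⟦ p ⟧ₚ x ≡ f x) → Expr

⟦_⟧ : Expr → ℤ → ℤ
⟦ var ⟧ x = x
⟦ con c ⟧ x = c
⟦ e :+ f ⟧ x = ⟦ e ⟧ x + ⟦ f ⟧ x
⟦ e :- f ⟧ x = ⟦ e ⟧ x - ⟦ f ⟧ x
⟦ e :* f ⟧ x = ⟦ e ⟧ x * ⟦ f ⟧ x
⟦ e :^ n ⟧ x = ⟦ e ⟧ x ^ n
⟦ named f p _ ⟧ x = f x

normalise : Expr → Poly
normalise var = 0ℤ ∷ 1ℤ ∷ []
normalise (con c) = c ∷ []
normalise (e :+ f) = normalise e +ₚ normalise f
normalise (e :- f) = normalise e +ₚ -1ℤ ·ₚ normalise f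
normalise (e :* f) = normalise e *ₚ normalise f
normalise (e :^ n) = normalise e ^ₚ n
normalise (named f p _) = p

normalise-sound : ∀ e x → ⟦ normalise e ⟧ₚ x ≡ ⟦ e ⟧ x
normalise-sound var x = step x
  where
  step : ∀ x → 0ℤ + x * (1ℤ + x * 0ℤ) ≡ x
  step = solve-∀
normalise-sound (con c) x = trans (cong (λ t → c + t) (*-zeroʳ x)) (+-identityʳ c)
normalise-sound (e :+ f) x
  rewrite ⟦⟧ₚ-+ (normalise e) (normalise f) x | normalise-sound e x | normalise-sound f x = refl
normalise-sound (e :- f) x
  rewrite ⟦⟧ₚ-+ (normalise e) (-1ℤ ·ₚ normalise f) x | ⟦⟧ₚ-· -1ℤ (normalise f) x
        | normalise-sound e x | normalise-sound f x = cong (λ t → ⟦ e ⟧ x + t) (-1*i≡-i (⟦ f ⟧ x))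
normalise-sound (e :* f) x
  rewrite ⟦⟧ₚ-* (normalise e) (normalise f) x | normalise-sound e x | normalise-sound f x = refl
normalise-sound (e :^ n) x rewrite ⟦⟧ₚ-^ (normalise e) n x | normalise-sound e x = refl
normalise-sound (named f p p≡f) x = p≡f x

≡-by-normalisation : ∀ e f → True (All.all? (_≟ 0ℤ) (normalise (e :- f))) →
  ∀ x → ⟦ e ⟧ x ≡ ⟦ f ⟧ x
≡-by-normalisation e f e-f≡0 x = i-j≡0⇒i≡j (⟦ e ⟧ x) (⟦ f ⟧ x) (begin
  ⟦ e :- f ⟧ x               ≡⟨ normalise-sound (e :- f) x ⟨
  ⟦ normalise (e :- f) ⟧ₚ x  ≡⟨ ⟦⟧ₚ-zero (toWitness e-f≡0) x ⟩
  0ℤ                         ∎)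
  where open ≡-Reasoning

Admissible : ℤ → Set
Admissible u = u ≢ 0ℤ × u ≢ 1ℤ × u ≢ -1ℤ

⟦⟧ₚ-cong-∣ : ∀ p {m x y} → m ∣ x - y → m ∣ ⟦ p ⟧ₚ x - ⟦ p ⟧ₚ y
⟦⟧ₚ-cong-∣ [] _ = divides 0ℤ refl
⟦⟧ₚ-cong-∣ (c ∷ p) {m} {x} {y} m∣x-y =
  subst (m ∣_) (sym (step c x y (⟦ p ⟧ₚ x) (⟦ p ⟧ₚ y)))
    (∣m∣n⇒∣m+n (∣m⇒∣m*n (⟦ p ⟧ₚ x) m∣x-y) (∣n⇒∣m*n y (⟦⟧ₚ-cong-∣ p m∣x-y)))
  where
  step : ∀ c x y s t → (c + x * s) - (c + y * t) ≡ (x - y) * s + y * (s - t)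
  step = solve-∀

RootlessModulo : ℕ → Poly → Set
RootlessModulo m p = ∀ (r : Fin m) → ¬ (+ m ∣ ⟦ p ⟧ₚ (+ toℕ r))

rootlessModulo? : ∀ m p → Dec (RootlessModulo m p)
rootlessModulo? m p = all? λ r → ¬? (+ m ∣? ⟦ p ⟧ₚ (+ toℕ r))

rootlessModulo⇒≢0 : ∀ m .{{_ : NonZero m}} p → RootlessModulo m p → ∀ x → ⟦ p ⟧ₚ x ≢ 0ℤ
rootlessModulo⇒≢0 m p rootless x p[x]≡0 = rootless r m∣p[r]
  where
  r : Fin m
  r = fromℕ< (n%ℕd<d x m)

  x≡r+qm : x ≡ + toℕ r + x /ℕ m * + m
  x≡r+qm = trans (a≡a%ℕn+[a/ℕn]*n x m) (cong (λ t → + t + x /ℕ m * + m) (sym (toℕ-fromℕ< _)))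

  m∣r-x : + m ∣ + toℕ r - x
  m∣r-x = divides (- (x /ℕ m))
    (subst (λ t → + toℕ r - t ≡ - (x /ℕ m) * + m) (sym x≡r+qm) (step (+ toℕ r) (x /ℕ m) (+ m)))
    where
    step : ∀ r q m → r - (r + q * m) ≡ - q * m
    step = solve-∀

  m∣p[r] : + m ∣ ⟦ p ⟧ₚ (+ toℕ r)
  m∣p[r] = subst (+ m ∣_) (trans (cong (λ t → ⟦ p ⟧ₚ (+ toℕ r) - t) p[x]≡0) (+-identityʳ _))
    (⟦⟧ₚ-cong-∣ p m∣r-x)

quotient : ℤ → Poly → Poly
quotient c [] = []
quotient c (a ∷ p) = ⟦ p ⟧ₚ c ∷ quotient c p

factor-theorem : ∀ c p x → ⟦ p ⟧ₚ x ≡ (x - c) * ⟦ quotient c p ⟧ₚ x + ⟦ p ⟧ₚ c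
factor-theorem c [] x = sym (step x c)
  where
  step : ∀ x c → (x - c) * 0ℤ + 0ℤ ≡ 0ℤ
  step = solve-∀
factor-theorem c (a ∷ p) x rewrite factor-theorem c p x =
  step a c x (⟦ quotient c p ⟧ₚ x) (⟦ p ⟧ₚ c)
  where
  step : ∀ a c x q r → a + x * ((x - c) * q + r) ≡ (x - c) * (r + x * q) + (a + c * r)
  step = solve-∀

root-factor : ∀ {c} p x → ⟦ p ⟧ₚ c ≡ 0ℤ → ⟦ p ⟧ₚ x ≡ (x - c) * ⟦ quotient c p ⟧ₚ x
root-factor {c} p x p[c]≡0 = begin
  ⟦ p ⟧ₚ x                                  ≡⟨ factor-theorem c p x ⟩
  (x - c) * ⟦ quotient c p ⟧ₚ x + ⟦ p ⟧ₚ c  ≡⟨ cong (λ t → (x - c) * ⟦ quotient c p ⟧ₚ x + t) p[c]≡0 ⟩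
  (x - c) * ⟦ quotient c p ⟧ₚ x + 0ℤ        ≡⟨ +-identityʳ _ ⟩
  (x - c) * ⟦ quotient c p ⟧ₚ x             ∎
  where open ≡-Reasoning

deflate : ℤ → ℕ → Poly → Poly
deflate c zero p = p
deflate c (suc n) p with ⟦ p ⟧ₚ c ≟ 0ℤ
... | yes _ = deflate c n (quotient c p)
... | no _ = p

deflate-≢0 : ∀ {c x} n p → x ≢ c → ⟦ deflate c n p ⟧ₚ x ≢ 0ℤ → ⟦ p ⟧ₚ x ≢ 0ℤ
deflate-≢0 zero p _ q[x]≢0 = q[x]≢0
deflate-≢0 {c} {x} (suc n) p x≢c q[x]≢0 p[x]≡0 with ⟦ p ⟧ₚ c ≟ 0ℤ
... | no _ = q[x]≢0 p[x]≡0
... | yes p[c]≡0 with i*j≡0⇒i≡0∨j≡0 (x - c) (trans (sym (root-factor p x p[c]≡0)) p[x]≡0)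
...   | inj₁ x-c≡0 = x≢c (i-j≡0⇒i≡j x c x-c≡0)
...   | inj₂ q[x]≡0 = deflate-≢0 n (quotient c p) x≢c q[x]≢0 q[x]≡0

deflateExcluded : Poly → Poly
deflateExcluded p = deflate -1ℤ n (deflate 1ℤ n (deflate 0ℤ n p))
  where n = length p

deflateExcluded-≢0 : ∀ {u} p → Admissible u → ⟦ deflateExcluded p ⟧ₚ u ≢ 0ℤ → ⟦ p ⟧ₚ u ≢ 0ℤ
deflateExcluded-≢0 p (u≢0 , u≢1 , u≢-1) =
  deflate-≢0 n p u≢0
  ∘ deflate-≢0 n (deflate 0ℤ n p) u≢1
  ∘ deflate-≢0 n (deflate 1ℤ n (deflate 0ℤ n p)) u≢-1
  where n = length p

^-≢0 : ∀ {x} n → x ≢ 0ℤ → x ^ n ≢ 0ℤ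
^-≢0 zero x≢0 ()
^-≢0 {x} (suc n) x≢0 xⁿ⁺¹≡0 with i*j≡0⇒i≡0∨j≡0 x xⁿ⁺¹≡0
... | inj₁ x≡0 = x≢0 x≡0
... | inj₂ xⁿ≡0 = ^-≢0 n x≢0 xⁿ≡0

-- 105 = 3 · 5 · 7: once u, u - 1 and u + 1 are divided out, every factor tested
-- below has no root modulo one of these primes.
hasNoRootModulo105? : Expr → Bool
hasNoRootModulo105? e = isYes (rootlessModulo? 105 (deflateExcluded (normalise e)))

nonvanishing? : Expr → Bool
nonvanishing? (e :* f) = nonvanishing? e ∧ nonvanishing? f
nonvanishing? (e :^ n) = nonvanishing? e
nonvanishing? var = hasNoRootModulo105? var
nonvanishing? (con c) = hasNoRootModulo105? (con c)
nonvanishing? (e :+ f) = hasNoRootModulo105? (e :+ f)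
nonvanishing? (e :- f) = hasNoRootModulo105? (e :- f)
nonvanishing? (named f p h) = hasNoRootModulo105? (named f p h)

hasNoRootModulo105⇒≢0 : ∀ e {u} → T (hasNoRootModulo105? e) → Admissible u → ⟦ e ⟧ u ≢ 0ℤ
hasNoRootModulo105⇒≢0 e {u} h adm =
  subst (_≢ 0ℤ) (normalise-sound e u)
    (deflateExcluded-≢0 (normalise e) adm (rootlessModulo⇒≢0 105 p (toWitness h) u))
  where p = deflateExcluded (normalise e)

nonvanishing : ∀ e {u} → T (nonvanishing? e) → Admissible u → ⟦ e ⟧ u ≢ 0ℤ
nonvanishing (e :* f) {u} h adm ef≡0 with Equivalence.to T-∧ h | i*j≡0⇒i≡0∨j≡0 (⟦ e ⟧ u) ef≡0
... | he , _ | inj₁ e≡0 = nonvanishing e he adm e≡0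
... | _ , hf | inj₂ f≡0 = nonvanishing f hf adm f≡0
nonvanishing (e :^ n) h adm = ^-≢0 n (nonvanishing e h adm)
nonvanishing var = hasNoRootModulo105⇒≢0 var
nonvanishing (con c) = hasNoRootModulo105⇒≢0 (con c)
nonvanishing (e :+ f) = hasNoRootModulo105⇒≢0 (e :+ f)
nonvanishing (e :- f) = hasNoRootModulo105⇒≢0 (e :- f)
nonvanishing (named f p h) = hasNoRootModulo105⇒≢0 (named f p h)

-- Reflecting the factors as atoms makes ⟦ ‵A ⟧ u contain P1 u, u ^ 2 + ι 1, … verbatim, so
-- it is convertible with A u without the type checker unfolding integer multiplication.
reflect : (f : ℤ → ℤ) (e : Expr) → (∀ x → ⟦ e ⟧ x ≡ f x) → Expr
reflect f e e≡f = named f (normalise e) λ x → trans (normalise-sound e x) (e≡f x)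

evenPoly : List ℤ → Expr
evenPoly [] = con 0ℤ
evenPoly (c ∷ cs) = con c :+ var :^ 2 :* evenPoly cs

PairwiseSquares : ℤ → ℤ → ℤ → ℤ → ℤ → Set
PairwiseSquares n a b c d =
  IsSquare (a * b + n) × IsSquare (a * c + n) × IsSquare (a * d + n) ×
  IsSquare (b * c + n) × IsSquare (b * d + n) × IsSquare (c * d + n)

square-by-normalisation : ∀ w e → True (All.all? (_≟ 0ℤ) (normalise (w :* w :- e))) →
  ∀ u → IsSquare (⟦ e ⟧ u)
square-by-normalisation w e w²≡e u = ⟦ w ⟧ u , ≡-by-normalisation (w :* w) e w²≡e u

twice-squares-distinct : ∀ {s t} x y → s ≡ ι 2 * x ^ 2 → t ≡ ι 2 * y ^ 2 →
  (x - y) * (x + y) ≢ 0ℤ → s ≢ t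
twice-squares-distinct x y refl refl [x-y][x+y]≢0 s≡t =
  [ (λ ()) , [x-y][x+y]≢0 ]′ (i*j≡0⇒i≡0∨j≡0 (ι 2) (trans (step x y) (i≡j⇒i-j≡0 s≡t)))
  where
  -- Defs' x ^ 2 is x * (x * 1ℤ) by definition, which is the form the ring solver understands.
  step : ∀ x y → ι 2 * ((x - y) * (x + y)) ≡ ι 2 * (x * (x * 1ℤ)) - ι 2 * (y * (y * 1ℤ))
  step = solve-∀

twice-squares-product : ∀ x y → IsSquare (ι 2 * x ^ 2 * (ι 2 * y ^ 2) + 0ℤ)
twice-squares-product x y = ι 2 * x * y , step x y
  where
  step : ∀ x y → ι 2 * x * y * (ι 2 * x * y) ≡ ι 2 * (x * (x * 1ℤ)) * (ι 2 * (y * (y * 1ℤ))) + 0ℤ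
  step = solve-∀

twice-squares-D0 : ∀ {a b c d} x y z w →
  a ≡ ι 2 * x ^ 2 → b ≡ ι 2 * y ^ 2 → c ≡ ι 2 * z ^ 2 → d ≡ ι 2 * w ^ 2 → PairwiseSquares 0ℤ a b c d
twice-squares-D0 x y z w refl refl refl refl =
    twice-squares-product x y , twice-squares-product x z , twice-squares-product x w
  , twice-squares-product y z , twice-squares-product y w , twice-squares-product z w

distinct-by-half-roots : ∀ x y {s t u} → s ≡ ι 2 * ⟦ x ⟧ u ^ 2 → t ≡ ι 2 * ⟦ y ⟧ u ^ 2 →
  T (nonvanishing? ((x :- y) :* (x :+ y))) → Admissible u → s ≢ t
distinct-by-half-roots x y {u = u} s≡2x² t≡2y² h adm =
  twice-squares-distinct (⟦ x ⟧ u) (⟦ y ⟧ u) s≡2x² t≡2y² (nonvanishing ((x :- y) :* (x :+ y)) h adm)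

‵P1 ‵P2 ‵P3 ‵P4 ‵Q1 ‵Q2 ‵R1 ‵R2 : Expr
‵P1 = reflect P1
  (var :^ 6 :+ con (ι 2) :* var :^ 5 :+ var :^ 4 :- con (ι 4) :* var :^ 2 :- con (ι 4) :* var :- con (ι 4)) λ _ → refl
‵P2 = reflect P2
  (var :^ 6 :- con (ι 2) :* var :^ 5 :+ var :^ 4 :- con (ι 4) :* var :^ 2 :+ con (ι 4) :* var :- con (ι 4)) λ _ → refl
‵P3 = reflect P3 (var :^ 3 :- var :^ 2 :+ var :- con (ι 2)) λ _ → refl
‵P4 = reflect P4 (var :^ 3 :+ var :^ 2 :+ var :+ con (ι 2)) λ _ → refl
‵Q1 = reflect Q1
  (con (ι 2) :* var :^ 7 :- var :^ 6 :+ con (ι 2) :* var :^ 5 :- var :^ 4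
   :- con (ι 6) :* var :^ 3 :+ con (ι 4) :* var :^ 2 :- con (ι 8) :* var :+ con (ι 4)) λ _ → refl
‵Q2 = reflect Q2
  (con (ι 2) :* var :^ 7 :+ var :^ 6 :+ con (ι 2) :* var :^ 5 :+ var :^ 4
   :- con (ι 6) :* var :^ 3 :- con (ι 4) :* var :^ 2 :- con (ι 8) :* var :- con (ι 4)) λ _ → refl
‵R1 = reflect R1
  (con (ι 2) :* var :^ 8 :+ var :^ 6 :- con (ι 7) :* var :^ 4 :- con (ι 4) :* var :^ 2 :+ con (ι 4)) λ _ → refl
‵R2 = reflect R2 (var :^ 6 :+ var :^ 4 :- con (ι 2) :* var :^ 2 :- con (ι 4)) λ _ → refl

‵u-1 ‵u+1 ‵u²+1 ‵u²+2 ‵u²-2 ‵u⁴-2 ‵u⁴-3 : Expr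
‵u-1 = reflect (λ u → u - ι 1) (var :- con (ι 1)) λ _ → refl
‵u+1 = reflect (λ u → u + ι 1) (var :+ con (ι 1)) λ _ → refl
‵u²+1 = reflect (λ u → u ^ 2 + ι 1) (var :^ 2 :+ con (ι 1)) λ _ → refl
‵u²+2 = reflect (λ u → u ^ 2 + ι 2) (var :^ 2 :+ con (ι 2)) λ _ → refl
‵u²-2 = reflect (λ u → u ^ 2 - ι 2) (var :^ 2 :- con (ι 2)) λ _ → refl
‵u⁴-2 = reflect (λ u → u ^ 4 - ι 2) (var :^ 4 :- con (ι 2)) λ _ → refl
‵u⁴-3 = reflect (λ u → u ^ 4 - ι 3) (var :^ 4 :- con (ι 3)) λ _ → refl

‵A ‵B ‵C ‵D ‵N1 ‵N2 : Expr
‵A = con (ι 2) :* ‵P1 :^ 2 :* ‵P2 :^ 2 :* ‵P3 :^ 2 :* ‵P4 :^ 2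
‵B = con (ι 2) :* ‵Q1 :^ 2 :* ‵Q2 :^ 2 :* ‵u⁴-2 :^ 2
‵C = con (ι 2) :* ‵u²+1 :^ 2 :* ‵R1 :^ 2 :* ‵R2 :^ 2 :* var :^ 2 :* ‵u⁴-3 :^ 2
‵D = con (ι 8) :* ‵u-1 :^ 2 :* ‵u+1 :^ 2 :* var :^ 2 :* ‵u⁴-3 :^ 2 :* ‵P3 :^ 2 :* ‵P4 :^ 2
       :* ‵u²+1 :^ 4 :* ‵u²+2 :^ 2 :* ‵u²-2 :^ 2
‵N1 = ‵u-1 :^ 2 :* ‵u+1 :^ 2 :* ‵u⁴-3 :^ 2 :* ‵u²+1 :^ 2 :* ‵Q1 :^ 2 :* ‵Q2 :^ 2
       :* ‵P1 :^ 2 :* ‵P2 :^ 2 :* ‵P3 :^ 2 :* ‵P4 :^ 2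
‵N2 = con (ι 64) :* ‵u²+1 :^ 4 :* ‵u⁴-2 :^ 2 :* ‵R1 :^ 2 :* ‵R2 :^ 2
       :* var :^ 4 :* ‵u²+2 :^ 2 :* ‵u²-2 :^ 2 :* ‵u⁴-3 :^ 2 :* ‵P3 :^ 2 :* ‵P4 :^ 2

‵a ‵b ‵c ‵d : Expr
‵a = ‵P1 :* ‵P2 :* ‵P3 :* ‵P4
‵b = ‵Q1 :* ‵Q2 :* ‵u⁴-2
‵c = ‵u²+1 :* ‵R1 :* ‵R2 :* var :* ‵u⁴-3
‵d = con (ι 2) :* ‵u-1 :* ‵u+1 :* var :* ‵u⁴-3 :* ‵P3 :* ‵P4 :* ‵u²+1 :^ 2 :* ‵u²+2 :* ‵u²-2

A≡2a² : ∀ u → A u ≡ ι 2 * ⟦ ‵a ⟧ u ^ 2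
A≡2a² = ≡-by-normalisation ‵A (con (ι 2) :* ‵a :^ 2) tt

B≡2b² : ∀ u → B u ≡ ι 2 * ⟦ ‵b ⟧ u ^ 2
B≡2b² = ≡-by-normalisation ‵B (con (ι 2) :* ‵b :^ 2) tt

C≡2c² : ∀ u → C u ≡ ι 2 * ⟦ ‵c ⟧ u ^ 2
C≡2c² = ≡-by-normalisation ‵C (con (ι 2) :* ‵c :^ 2) tt

D≡2d² : ∀ u → D u ≡ ι 2 * ⟦ ‵d ⟧ u ^ 2
D≡2d² = ≡-by-normalisation ‵D (con (ι 2) :* ‵d :^ 2) tt

-- √(xy + n₁) is a product of factors of x and y times ρxy(u²); √(xy + n₂) uses instead the
-- ρ of the complementary pair.
ρAB ρAC ρAD ρBC ρBD ρCD : Expr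
ρAB = evenPoly (ι 5 ∷ 0ℤ ∷ - ι 4 ∷ 0ℤ ∷ ι 1 ∷ [])
ρAC = evenPoly (ι 16 ∷ - ι 32 ∷ ι 8 ∷ ι 52 ∷ - ι 7 ∷ - ι 26 ∷ ι 1 ∷ ι 4 ∷ [])
ρAD = evenPoly (ι 16 ∷ ι 96 ∷ ι 104 ∷ - ι 12 ∷ - ι 63 ∷ - ι 18 ∷ ι 9 ∷ ι 4 ∷ [])
ρBC = evenPoly (ι 64 ∷ ι 16 ∷ - ι 128 ∷ - ι 24 ∷ ι 108 ∷ ι 21 ∷ - ι 39 ∷ - ι 8 ∷ ι 5 ∷ ι 1 ∷ [])
ρBD = evenPoly (ι 16 ∷ ι 48 ∷ ι 8 ∷ - ι 32 ∷ - ι 7 ∷ ι 6 ∷ ι 1 ∷ [])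
ρCD = evenPoly (ι 256 ∷ - ι 256 ∷ - ι 640 ∷ ι 2624 ∷ ι 5216 ∷ ι 400 ∷ - ι 5000 ∷ - ι 2756
              ∷ ι 1537 ∷ ι 1584 ∷ - ι 26 ∷ - ι 352 ∷ - ι 63 ∷ ι 28 ∷ ι 8 ∷ [])

N1-squares : ∀ u → PairwiseSquares (N1 u) (A u) (B u) (C u) (D u)
N1-squares u =
    square-by-normalisation (‵a :* ‵Q1 :* ‵Q2 :* ρAB)
                            (‵A :* ‵B :+ ‵N1) tt u
  , square-by-normalisation (‵a :* ‵u²+1 :^ 2 :* ‵u⁴-3 :* ρAC)
                            (‵A :* ‵C :+ ‵N1) tt u
  , square-by-normalisation (‵a :* ‵u-1 :* ‵u+1 :* ‵u²+1 :* ‵u⁴-3 :* ρAD)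
                            (‵A :* ‵D :+ ‵N1) tt u
  , square-by-normalisation (‵Q1 :* ‵Q2 :* ‵u²+1 :^ 2 :* ‵u⁴-3 :* ρBC)
                            (‵B :* ‵C :+ ‵N1) tt u
  , square-by-normalisation (‵P3 :* ‵P4 :* ‵Q1 :* ‵Q2 :* ‵u-1 :* ‵u+1 :* ‵u²+1 :* ‵u⁴-3 :* ρBD)
                            (‵B :* ‵D :+ ‵N1) tt u
  , square-by-normalisation (‵P3 :* ‵P4 :* ‵u-1 :* ‵u+1 :* ‵u²+1 :* ‵u⁴-3 :* ρCD)
                            (‵C :* ‵D :+ ‵N1) tt u

N2-squares : ∀ u → PairwiseSquares (N2 u) (A u) (B u) (C u) (D u)
N2-squares u =
    square-by-normalisation (con (ι 2) :* ‵P3 :* ‵P4 :* ‵u⁴-2 :* ρCD)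
                            (‵A :* ‵B :+ ‵N2) tt u
  , square-by-normalisation (con (ι 2) :* ‵P3 :* ‵P4 :* ‵R1 :* ‵R2 :* var :* ‵u²+1 :* ‵u⁴-3 :* ρBD)
                            (‵A :* ‵C :+ ‵N2) tt u
  , square-by-normalisation (con (ι 4) :* ‵P3 :* ‵P4 :* var :* ‵u²+1 :^ 3 :* ‵u²+2 :* ‵u²-2 :* ‵u⁴-3 :* ρBC)
                            (‵A :* ‵D :+ ‵N2) tt u
  , square-by-normalisation (con (ι 2) :* ‵R1 :* ‵R2 :* var :* ‵u²+1 :* ‵u⁴-2 :* ‵u⁴-3 :* ρAD)
                            (‵B :* ‵C :+ ‵N2) tt u
  , square-by-normalisation (con (ι 4) :* ‵P3 :* ‵P4 :* var :* ‵u²+1 :^ 3 :* ‵u²+2 :* ‵u²-2 :* ‵u⁴-2 :* ‵u⁴-3 :* ρAC)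
                            (‵B :* ‵D :+ ‵N2) tt u
  , square-by-normalisation (con (ι 4) :* ‵P3 :* ‵P4 :* ‵R1 :* ‵R2 :* var :^ 2 :* ‵u²+1 :^ 2 :* ‵u²+2 :* ‵u²-2 :* ‵u⁴-3 :* ρAB)
                            (‵C :* ‵D :+ ‵N2) tt u

proposition2 : (u : ℤ) → u ≢ 0ℤ → u ≢ 1ℤ → u ≢ -1ℤ →
    DQuadruple (N1 u) (A u) (B u) (C u) (D u) ×
    DQuadruple (N2 u) (A u) (B u) (C u) (D u) ×
    DQuadruple (N3 u) (A u) (B u) (C u) (D u)
proposition2 u u≢0 u≢1 u≢-1 =
    (nonzero , distinct , N1-squares u)
  , (nonzero , distinct , N2-squares u)
  , (nonzero , distinct , twice-squares-D0 (⟦ ‵a ⟧ u) (⟦ ‵b ⟧ u) (⟦ ‵c ⟧ u) (⟦ ‵d ⟧ u)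
                            (A≡2a² u) (B≡2b² u) (C≡2c² u) (D≡2d² u))
  where
  adm : Admissible u
  adm = u≢0 , u≢1 , u≢-1

  nonzero : A u ≢ 0ℤ × B u ≢ 0ℤ × C u ≢ 0ℤ × D u ≢ 0ℤ
  nonzero =
    nonvanishing ‵A tt adm , nonvanishing ‵B tt adm , nonvanishing ‵C tt adm , nonvanishing ‵D tt adm

  distinct : A u ≢ B u × A u ≢ C u × A u ≢ D u × B u ≢ C u × B u ≢ D u × C u ≢ D u
  distinct =
      distinct-by-half-roots ‵a ‵b (A≡2a² u) (B≡2b² u) tt adm
    , distinct-by-half-roots ‵a ‵c (A≡2a² u) (C≡2c² u) tt adm
    , distinct-by-half-roots ‵a ‵d (A≡2a² u) (D≡2d² u) tt adm
    , distinct-by-half-roots ‵b ‵c (B≡2b² u) (C≡2c² u) tt adm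
    , distinct-by-half-roots ‵b ‵d (B≡2b² u) (D≡2d² u) tt adm
    , distinct-by-half-roots ‵c ‵d (C≡2c² u) (D≡2d² u) tt adm
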